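{- Let $F$ be a DQBF in prenex CNF. Applying autarky-reduction steps to $F$ as long as possible, in any order, terminates in the largest lean sub-DQBF of $F$ (the lean kernel of $F$); in particular the result does not depend on the order of the reduction steps.
   Context: A DQBF (dependency quantified Boolean formula) in CNF has the form $\forall x_1,\dots,x_n\,\exists y_1(D_1)\cdots\exists y_m(D_m): F_0$, where the $x_i$ are universal variables, the $y_j$ are existential variables, each dependency set $D_j\subseteq\{x_1,\dots,x_n\}$, and the matrix $F_0$ is a set of clauses over these variables. An autarky for $F$ is a partial assignment $\varphi$ to the existential variables which assigns to each variable $y_j$ in its domain a Boolean function of the universal variables in $D_j$, such that every clause of $F_0$ touched by $\varphi$ (i.e. containing a variable in the domain of $\varphi$) becomes a tautology after substituting the assigned functions for the assigned variables. An autarky is trivial if it touches no clause (e.g. the empty assignment); $F$ is lean if it has no non-trivial autarky. A sub-DQBF of $F$ is a DQBF with the same variables and dependency sets whose matrix is a subset of the clauses of $F_0$; the largest lean sub-DQBF (lean kernel) exists since the union of two lean sub-DQBFs is lean. For an autarky $\varphi$ of $F$, $F[\varphi]$ is the DQBF obtained by removing all clauses touched by $\varphi$; an autarky-reduction step transforms $F$ into $F[\varphi]$ for a non-trivial autarky $\varphi$ of $F$. -}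

module Defs where

open import Data.Nat using (ℕ)
open import Data.Empty using (⊥)
open import Data.Fin using (Fin)
open import Data.Bool using (Bool; true; false; not; _∧_)
open import Data.List using (List)
open import Data.List.Relation.Unary.Any using (Any)
open import Data.Maybe using (Maybe; just; nothing)
open import Data.Product using (Σ; _×_; ∃; ∃-syntax; _,_)
open import Relation.Binary.PropositionalEquality using (_≡_)
open import Relation.Nullary using (¬_)
open import Relation.Binary.Construct.Closure.ReflexiveTransitive using (Star)
open import Induction.WellFounded using (Acc)

data Var (n m : ℕ) : Set where
  univ  : Fin n → Var n m
  exist : Fin m → Var n m

-- A literal: a variable together with a polarity (true = positive).
record Lit (n m : ℕ) : Set where
  constructor lit
  field
    var : Var n m
    pol : Bool

Clause : ℕ → ℕ → Set
Clause n m = List (Lit n m)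

-- A DQBF in prenex CNF: dependency sets D_j ⊆ {x_1..x_n} (as characteristic
-- functions) and a matrix given by k clauses C_0 .. C_(k-1).
record DQBF : Set where
  field
    n m k : ℕ
    dep    : Fin m → Fin n → Bool
    clause : Fin k → Clause n m

module _ (F : DQBF) where
  open DQBF F

  -- A sub-DQBF of F: same variables and dependency sets, matrix a subset
  -- of the clauses of F (given by its characteristic function on Fin k).
  SubDQBF : Set
  SubDQBF = Fin k → Bool

  full : SubDQBF
  full _ = true

  _⊆_ : SubDQBF → SubDQBF → Set
  S ⊆ T = ∀ i → S i ≡ true → T i ≡ true

  UAssign : Set
  UAssign = Fin n → Bool

  DepFun : Fin m → Set
  DepFun j = Σ (UAssign → Bool) λ f →
    ∀ (a b : UAssign) → (∀ i → dep j i ≡ true → a i ≡ b i) → f a ≡ f b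

  PAssign : Set
  PAssign = (j : Fin m) → Maybe (DepFun j)

  InDom : PAssign → Fin m → Set
  InDom φ j = ∃[ f ] (φ j ≡ just f)

  TouchesLit : PAssign → Lit n m → Set
  TouchesLit φ (lit (univ i)  p) = ⊥
  TouchesLit φ (lit (exist j) p) = InDom φ j

  Touches : PAssign → Clause n m → Set
  Touches φ C = Any (TouchesLit φ) C

  -- Value of a variable after substituting the functions of φ, under a
  -- universal assignment a and an assignment e to the remaining
  -- (unassigned) existential variables.
  varVal : PAssign → UAssign → (Fin m → Bool) → Var n m → Bool
  varVal φ a e (univ i)  = a i
  varVal φ a e (exist j) with φ j
  ... | just (f , _) = f a
  ... | nothing      = e j

  litVal : PAssign → UAssign → (Fin m → Bool) → Lit n m → Bool
  litVal φ a e (lit v true)  = varVal φ a e v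
  litVal φ a e (lit v false) = not (varVal φ a e v)

  TautAfter : PAssign → Clause n m → Set
  TautAfter φ C = ∀ (a : UAssign) (e : Fin m → Bool) →
    Any (λ l → litVal φ a e l ≡ true) C

  IsAutarky : SubDQBF → PAssign → Set
  IsAutarky S φ = ∀ i → S i ≡ true → Touches φ (clause i) → TautAfter φ (clause i)

  NonTrivial : SubDQBF → PAssign → Set
  NonTrivial S φ = ∃[ i ] (S i ≡ true × Touches φ (clause i))

  Lean : SubDQBF → Set
  Lean S = ∀ φ → IsAutarky S φ → ¬ NonTrivial S φ

  Removed : SubDQBF → PAssign → SubDQBF → Set
  Removed S φ S' = ∀ i → (S' i ≡ true → S i ≡ true × ¬ Touches φ (clause i))
                       × (S i ≡ true → ¬ Touches φ (clause i) → S' i ≡ true)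

  Step : SubDQBF → SubDQBF → Set
  Step S S' = ∃[ φ ] (IsAutarky S φ × NonTrivial S φ × Removed S φ S')

  Reduces : SubDQBF → SubDQBF → Set
  Reduces = Star Step

  Irreducible : SubDQBF → Set
  Irreducible S = ∀ S' → ¬ Step S S'

  IsLeanKernel : SubDQBF → Set
  IsLeanKernel K = Lean K × (∀ T → Lean T → T ⊆ K)

  Terminates : SubDQBF → Set
  Terminates S = Acc (λ S' S → Step S S') S

module Submission where

-- Each reduction step deletes at least one clause, so reduction terminates.
-- An autarky of a sub-DQBF S is also an autarky of every T ⊆ S; if T is lean
-- it therefore touches no clause of T, so no step ever deletes a clause of a
-- lean T ⊆ S. An irreducible S is lean (a non-trivial autarky would give one
-- more step), and it contains every lean sub-DQBF of F: it is the lean kernel.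

open import Defs
open import Data.Bool using (true; false)
open import Data.Empty using (⊥-elim)
open import Data.Fin.Subset using (Subset; _∈_; _⊂_)
open import Data.Fin.Subset.Induction using (⊂-wellFounded)
open import Data.List.Relation.Unary.Any using (any?)
open import Data.Maybe using (just; nothing)
open import Data.Product using (_×_; _,_; proj₁; proj₂)
open import Data.Vec using (tabulate)
open import Data.Vec.Properties using (lookup∘tabulate; []=⇒lookup; lookup⇒[]=)
open import Function using (flip)
open import Induction.WellFounded using (WellFounded; module Subrelation)
open import Relation.Binary.Construct.Closure.ReflexiveTransitive using (ε; _◅_)
open import Relation.Binary.PropositionalEquality using (_≡_; refl; trans; sym)
import Relation.Binary.Construct.On as On
open import Relation.Nullary using (Dec; yes; no)

module _ (F : DQBF) where
  open DQBF F

  toSubset : SubDQBF F → Subset k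
  toSubset = tabulate

  ∈-toSubset : ∀ {S i} → S i ≡ true → i ∈ toSubset S
  ∈-toSubset {S} {i} Si = lookup⇒[]= i (toSubset S) (trans (lookup∘tabulate S i) Si)

  ∈-toSubset⁻ : ∀ {S i} → i ∈ toSubset S → S i ≡ true
  ∈-toSubset⁻ {S} {i} i∈S = trans (sym (lookup∘tabulate S i)) ([]=⇒lookup i∈S)

  step-⊂ : ∀ {S S′} → Step F S S′ → toSubset S′ ⊂ toSubset S
  step-⊂ (φ , _ , (i , Si , touched) , removed) =
    (λ i∈S′ → ∈-toSubset (proj₁ (proj₁ (removed _) (∈-toSubset⁻ i∈S′))))
    , i , ∈-toSubset Si , λ i∈S′ → proj₂ (proj₁ (removed i) (∈-toSubset⁻ i∈S′)) touched

  step-wellFounded : WellFounded (flip (Step F))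
  step-wellFounded =
    Subrelation.wellFounded step-⊂ (On.wellFounded toSubset ⊂-wellFounded)

  inDom? : ∀ φ j → Dec (InDom F φ j)
  inDom? φ j with φ j
  ... | just f  = yes (f , refl)
  ... | nothing = no λ { (_ , ()) }

  touchesLit? : ∀ φ l → Dec (TouchesLit F φ l)
  touchesLit? φ (lit (univ i)  _) = no λ ()
  touchesLit? φ (lit (exist j) _) = inDom? φ j

  touches? : ∀ φ C → Dec (Touches F φ C)
  touches? φ = any? (touchesLit? φ)

  reduct : SubDQBF F → PAssign F → SubDQBF F
  reduct S φ i with touches? φ (clause i)
  ... | yes _ = false
  ... | no  _ = S i

  reduct-removed : ∀ S φ → Removed F S φ (reduct S φ)
  reduct-removed S φ i with touches? φ (clause i)
  ... | yes touched = (λ ()) , λ _ untouched → ⊥-elim (untouched touched)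
  ... | no untouched = (λ Si → Si , untouched) , λ Si _ → Si

  irreducible⇒lean : ∀ {S} → Irreducible F S → Lean F S
  irreducible⇒lean {S} irreducible φ autarky nonTrivial =
    irreducible (reduct S φ) (φ , autarky , nonTrivial , reduct-removed S φ)

  step-preserves-lean-⊆ : ∀ {T S S′} → Lean F T →
    _⊆_ F T S → Step F S S′ → _⊆_ F T S′
  step-preserves-lean-⊆ lean T⊆S (φ , autarky , _ , removed) i Ti
    with touches? φ (clause i)
  ... | no untouched = proj₂ (removed i) (T⊆S i Ti) untouched
  ... | yes touched  =
    ⊥-elim (lean φ (λ j Tj → autarky j (T⊆S j Tj)) (i , Ti , touched))

  reduces-preserves-lean-⊆ : ∀ {T S S′} → Lean F T →
    _⊆_ F T S → Reduces F S S′ → _⊆_ F T S′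
  reduces-preserves-lean-⊆ lean T⊆S ε          = T⊆S
  reduces-preserves-lean-⊆ lean T⊆S (st ◅ sts) =
    reduces-preserves-lean-⊆ lean (step-preserves-lean-⊆ lean T⊆S st) sts

lemma4 : (F : DQBF) →
    Terminates F (full F) ×
    (∀ S → Reduces F (full F) S → Irreducible F S → IsLeanKernel F S)
lemma4 F = step-wellFounded F (full F) , λ S reduces irreducible →
    irreducible⇒lean F irreducible
  , λ T lean → reduces-preserves-lean-⊆ F lean (λ _ _ → refl) reduces
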